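{- Let $R$ be a unique factorization domain with field of fractions $K$. Let $d\ge 2$, fix $i$ with $0<i<d$, and let $a_j\in K$ be given for $j\in\{0,\dots,d\}\setminus\{i\}$ with $a_0a_d\neq 0$. Then there is a finite set $\{y_1,\dots,y_m\}\subseteq K$, depending only on $\{a_j : j\neq i\}$, such that for every choice of $a_i\in R$ and every root $z\in K$ of $f(x)=a_dx^d+\cdots+a_1x+a_0$, the quotient $z/y_j$ is a unit of $R$ for some $j\in\{1,\dots,m\}$. -}

module Defs where

open import Level using (Level; _⊔_)
open import Algebra.Bundles using (CommutativeRing)
open import Data.Nat using (ℕ; zero; suc)
open import Data.Fin using (Fin; toℕ)
open import Data.Fin as F using ()
open import Data.List using (List; []; _∷_; foldr)
open import Data.List.Relation.Binary.Permutation.Propositional using (_↭_)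
open import Data.List.Relation.Binary.Pointwise using (Pointwise)
open import Data.List.Relation.Unary.All using (All)
open import Data.Product using (Σ; ∃; _×_; _,_)
open import Data.Sum using (_⊎_)
open import Relation.Nullary using (¬_; yes; no)
open import Relation.Binary.PropositionalEquality using (_≡_)

module _ {c ℓ : Level} (R : CommutativeRing c ℓ) where
  open CommutativeRing R

  IsUnit : Carrier → Set (c ⊔ ℓ)
  IsUnit u = ∃ λ v → u * v ≈ 1#

  Associated : Carrier → Carrier → Set (c ⊔ ℓ)
  Associated a b = ∃ λ u → IsUnit u × (a ≈ u * b)

  Irreducible : Carrier → Set (c ⊔ ℓ)
  Irreducible p = (¬ p ≈ 0#) × (¬ IsUnit p)
    × (∀ a b → p ≈ a * b → IsUnit a ⊎ IsUnit b)

  prod : List Carrier → Carrier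
  prod = foldr _*_ 1#

  IsIntegralDomain : Set (c ⊔ ℓ)
  IsIntegralDomain = (¬ 1# ≈ 0#) × (∀ a b → a * b ≈ 0# → a ≈ 0# ⊎ b ≈ 0#)

  record IsUFD : Set (c ⊔ ℓ) where
    field
      isIntegralDomain : IsIntegralDomain
      factor : ∀ a → ¬ a ≈ 0# →
        ∃ λ u → ∃ λ ps → IsUnit u × All Irreducible ps × (a ≈ u * prod ps)
      unique : ∀ ps qs → All Irreducible ps → All Irreducible qs →
        Associated (prod ps) (prod qs) →
        ∃ λ qs′ → (qs ↭ qs′) × Pointwise Associated ps qs′

  -- The field of fractions K of R (standard construction: pairs n/d with d ≠ 0,
  -- n/d ≈ n'/d' iff n*d' ≈ n'*d).
  record Frac : Set (c ⊔ ℓ) where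
    constructor _/_[_]
    field
      num : Carrier
      den : Carrier
      den≉0 : ¬ den ≈ 0#

  open Frac public

  module FracOps (dom : IsIntegralDomain) where
    open Data.Product using (proj₁; proj₂)

    private
      nz* : ∀ {a b} → ¬ a ≈ 0# → ¬ b ≈ 0# → ¬ (a * b) ≈ 0#
      nz* {a} {b} a≉0 b≉0 ab≈0 with proj₂ dom a b ab≈0
      ... | Data.Sum.inj₁ x = a≉0 x
      ... | Data.Sum.inj₂ y = b≉0 y

    infix 4 _≈K_
    infixl 6 _+K_
    infixl 7 _*K_

    _≈K_ : Frac → Frac → Set ℓ
    x ≈K y = num x * den y ≈ num y * den x

    0K : Frac
    0K = 0# / 1# [ proj₁ dom ]

    1K : Frac
    1K = 1# / 1# [ proj₁ dom ]

    ι : Carrier → Frac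
    ι a = a / 1# [ proj₁ dom ]

    _+K_ : Frac → Frac → Frac
    x +K y = (num x * den y + num y * den x) / (den x * den y) [ nz* (den≉0 x) (den≉0 y) ]

    _*K_ : Frac → Frac → Frac
    x *K y = (num x * num y) / (den x * den y) [ nz* (den≉0 x) (den≉0 y) ]

    _^K_ : Frac → ℕ → Frac
    x ^K zero = 1K
    x ^K suc n = x *K (x ^K n)

    evalK : ∀ {n} → (Fin n → Frac) → Frac → Frac
    evalK {zero} cs z = 0K
    evalK {suc n} cs z = cs F.zero +K z *K evalK (λ j → cs (F.suc j)) z

    setCoeff : ∀ {n} → (Fin n → Frac) → Fin n → Carrier → Fin n → Frac
    setCoeff a i aᵢ j with j F.≟ i
    ... | yes _ = ι aᵢ
    ... | no _ = a j

module Submission where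

-- Clearing the denominators
-- of f turns the rational root test into: if z = p/q is a root then p ∣ A₀·q^d and
-- q ∣ A_d·p^d, where A₀ (A_d) is the numerator of a₀ (a_d) times the denominators of the
-- other coefficients.  As aᵢ ∈ R has denominator 1, A₀ and A_d do not depend on aᵢ.
-- Writing z = u·∏Ps/∏Qs with Ps, Qs irreducible and without common factor, unique
-- factorisation makes Ps a sub-multiset (up to associates) of the factors B₀ of A₀ and
-- Qs one of the factors B_d of A_d, so z is a unit times one of the finitely many
-- candidates ∏X·∏W/∏B_d.

open import Defs
open import Level using (_⊔_)
open import Algebra.Bundles using (CommutativeRing)
open import Data.Nat using (ℕ; zero; suc; _≤_; _<_; s≤s)
open import Data.Nat.Properties using (m≤m+n; <-irrefl; 1+n≢0; suc-injective)
open import Data.Fin as Fin using (Fin; zero; suc; toℕ; fromℕ)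
open import Data.Fin.Properties using (toℕ-fromℕ)
open import Data.Vec.Functional using (head; tail; init; last)
open import Data.List using (List; []; _∷_; _++_; [_]; length; cartesianProductWith)
open import Data.List.Properties using (length-++)
open import Data.List.Membership.Propositional using (_∈_)
open import Data.List.Membership.Propositional.Properties
  using (∈-++⁻; ∈-++⁺ˡ; ∈-∃++; ∈-cartesianProductWith⁺)
open import Data.List.Relation.Unary.All as All using (All; []; _∷_)
import Data.List.Relation.Unary.All.Properties as All
open import Data.List.Relation.Unary.Any using (here; there)
open import Data.List.Relation.Binary.Pointwise using (Pointwise; []; _∷_)
open import Data.List.Relation.Binary.Permutation.Propositional as Perm
  using (_↭_; ↭-refl; ↭-sym; ↭-trans; prep; swap)
open import Data.List.Relation.Binary.Permutation.Propositional.Properties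
  using (∈-resp-↭; All-resp-↭; ↭-length; shift; drop-∷; ++⁺ʳ; ++-comm)
open import Data.Product using (∃; ∃₂; _×_; _,_; proj₁; proj₂)
open import Data.Sum using (_⊎_; inj₁; inj₂)
open import Relation.Nullary using (¬_; contradiction; yes; no)
open import Data.Empty using (⊥)
open import Relation.Unary using (Pred)
open import Relation.Binary.Core using (REL)
open import Relation.Binary.PropositionalEquality as ≡ using (_≡_; _≢_)

-- Finite combinatorics of lists, viewed as multisets.
module _ {a} {A : Set a} where

  copies : ℕ → List A → List A
  copies zero    V = []
  copies (suc d) V = V ++ copies d V

  ∈-copies⁻ : ∀ d {V x} → x ∈ copies d V → x ∈ V
  ∈-copies⁻ (suc d) {V} x∈ with ∈-++⁻ V x∈
  ... | inj₁ x∈V    = x∈V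
  ... | inj₂ x∈rest = ∈-copies⁻ d x∈rest

  All-copies : ∀ {p} {P : Pred A p} d {V} → All P V → All P (copies d V)
  All-copies zero    pV = []
  All-copies (suc d) pV = All.++⁺ pV (All-copies d pV)

  extract : ∀ {x : A} {xs} → x ∈ xs → ∃ λ ys → xs ↭ x ∷ ys
  extract {x} x∈ with ys , zs , ≡.refl ← ∈-∃++ x∈ = ys ++ zs , shift x ys zs

  meets-or-sub : ∀ X {Y B C} → X ++ Y ↭ B ++ C →
                 (∃ λ x → x ∈ X × x ∈ C) ⊎ (∃ λ B′ → X ++ B′ ↭ B)
  meets-or-sub []      {B = B} _ = inj₂ (B , ↭-refl)
  meets-or-sub (x ∷ X) {Y} {B} {C} p with ∈-++⁻ B (∈-resp-↭ p (here ≡.refl))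
  ... | inj₂ x∈C = inj₁ (x , here ≡.refl , x∈C)
  ... | inj₁ x∈B with B₁ , B↭ ← extract x∈B
                 with meets-or-sub X {Y} {B₁} {C} (drop-∷ (↭-trans p (++⁺ʳ C B↭)))
  ...   | inj₁ (y , y∈X , y∈C) = inj₁ (y , there y∈X , y∈C)
  ...   | inj₂ (B′ , q)         = inj₂ (B′ , ↭-trans (prep x q) (↭-sym B↭))

  words : ℕ → List A → List (List A)
  words zero    E = [ [] ]
  words (suc n) E = [] ∷ cartesianProductWith _∷_ E (words n E)

  ∈-words : ∀ n {E L} → length L ≤ n → All (_∈ E) L → L ∈ words n E
  ∈-words zero    {L = []} _ [] = here ≡.refl
  ∈-words (suc n) {L = []} _ [] = here ≡.refl
  ∈-words (suc n) (s≤s len) (x∈E ∷ L⊆E) =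
    there (∈-cartesianProductWith⁺ _∷_ x∈E (∈-words n len L⊆E))

  subBags : List A → List (List A)
  subBags B = words (length B) B

  ∈-subBags : ∀ {X X′ B} → X ++ X′ ↭ B → X ∈ subBags B
  ∈-subBags {X} {X′} {B} X++X′↭B = ∈-words (length B) shorter members
    where
    shorter : length X ≤ length B
    shorter = ≡.subst (length X ≤_) (≡.trans (≡.sym (length-++ X)) (↭-length X++X′↭B))
                      (m≤m+n (length X) (length X′))
    members : All (_∈ B) X
    members = All.tabulate (λ x∈X → ∈-resp-↭ X++X′↭B (∈-++⁺ˡ x∈X))

module _ {a b r} {A : Set a} {B : Set b} {_∼_ : REL A B r} where

  pointwise-++⁻ : ∀ xs {ys zs} → Pointwise _∼_ (xs ++ ys) zs →
                  ∃₂ λ zs₁ zs₂ → zs ≡ zs₁ ++ zs₂ × Pointwise _∼_ xs zs₁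
  pointwise-++⁻ []       {zs = zs} _ = [] , zs , ≡.refl , []
  pointwise-++⁻ (x ∷ xs) (x∼z ∷ rest) with zs₁ , zs₂ , ≡.refl , xs∼zs₁ ← pointwise-++⁻ xs rest =
    _ ∷ zs₁ , zs₂ , ≡.refl , x∼z ∷ xs∼zs₁

  pointwise-∈ : ∀ {xs ys y} → Pointwise _∼_ xs ys → y ∈ ys → ∃ λ x → x ∈ xs × x ∼ y
  pointwise-∈ (x∼y ∷ _)    (here ≡.refl) = _ , here ≡.refl , x∼y
  pointwise-∈ (_ ∷ rest) (there y∈ys) with x , x∈xs , x∼y ← pointwise-∈ rest y∈ys =
    x , there x∈xs , x∼y

-- Products of lists, units and association in a commutative ring.
module RingFacts {c ℓ} (R : CommutativeRing c ℓ) where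
  open CommutativeRing R hiding (zero)
  open import Algebra.Properties.CommutativeSemiring.Exp commutativeSemiring public
    using (_^_; ^-distrib-*)
  open import Algebra.Definitions.RawMagma *-rawMagma public
    using (_∣_) renaming (_,_ to divides)
  open import Algebra.Properties.Group +-group using (inverseˡ-unique)
  open import Algebra.Properties.Ring ring using (-‿distribˡ-*)
  open import Algebra.Solver.Ring.NaturalCoefficients.Default commutativeSemiring
  open import Relation.Binary.Reasoning.Setoid setoid

  interchange : ∀ a b c d → (a * b) * (c * d) ≈ (a * c) * (b * d)
  interchange = solve 4 (λ a b c d → (a :* b) :* (c :* d) := (a :* c) :* (b :* d)) refl

  sum≈0⇒∣ : ∀ {x p t} → x + p * t ≈ 0# → p ∣ x
  sum≈0⇒∣ {x} {p} {t} x+pt≈0 = divides (- t) (begin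
    - t * p    ≈⟨ sym (-‿distribˡ-* t p) ⟩
    - (t * p)  ≈⟨ -‿cong (*-comm t p) ⟩
    - (p * t)  ≈⟨ sym (inverseˡ-unique x (p * t) x+pt≈0) ⟩
    x          ∎)

  prod-++ : ∀ xs ys → prod R (xs ++ ys) ≈ prod R xs * prod R ys
  prod-++ []       ys = sym (*-identityˡ _)
  prod-++ (x ∷ xs) ys = trans (*-congˡ (prod-++ xs ys)) (sym (*-assoc x _ _))

  prod-↭ : ∀ {xs ys} → xs ↭ ys → prod R xs ≈ prod R ys
  prod-↭ Perm.refl        = refl
  prod-↭ (prep x p)      = *-congˡ (prod-↭ p)
  prod-↭ (swap x y p)    = trans (x*[y*z]≈y*[x*z] x y _) (*-congˡ (*-congˡ (prod-↭ p)))
    where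
    x*[y*z]≈y*[x*z] : ∀ x y z → x * (y * z) ≈ y * (x * z)
    x*[y*z]≈y*[x*z] = solve 3 (λ x y z → x :* (y :* z) := y :* (x :* z)) refl
  prod-↭ (Perm.trans p q) = trans (prod-↭ p) (prod-↭ q)

  prod-copies : ∀ d V → prod R (copies d V) ≈ prod R V ^ d
  prod-copies zero    V = refl
  prod-copies (suc d) V = trans (prod-++ V (copies d V)) (*-congˡ (prod-copies d V))

  1-unit : IsUnit R 1#
  1-unit = 1# , *-identityˡ 1#

  *-unit : ∀ {u v} → IsUnit R u → IsUnit R v → IsUnit R (u * v)
  *-unit {u} {v} (u⁻¹ , uu⁻¹≈1) (v⁻¹ , vv⁻¹≈1) = u⁻¹ * v⁻¹ , (begin
    (u * v) * (u⁻¹ * v⁻¹) ≈⟨ interchange u v u⁻¹ v⁻¹ ⟩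
    (u * u⁻¹) * (v * v⁻¹) ≈⟨ *-cong uu⁻¹≈1 vv⁻¹≈1 ⟩
    1# * 1#               ≈⟨ *-identityˡ 1# ⟩
    1#                    ∎)

  inverse-unit : ∀ {u v} → u * v ≈ 1# → IsUnit R v
  inverse-unit {u} {v} uv≈1 = u , trans (*-comm v u) uv≈1

  ^-unit : ∀ {u} n → IsUnit R u → IsUnit R (u ^ n)
  ^-unit zero    _  = 1-unit
  ^-unit (suc n) uU = *-unit uU (^-unit n uU)

  associated-sym : ∀ {a b} → Associated R a b → Associated R b a
  associated-sym {a} {b} (u , (u⁻¹ , uu⁻¹≈1) , a≈ub) = u⁻¹ , inverse-unit uu⁻¹≈1 , (begin
    b              ≈⟨ sym (*-identityˡ b) ⟩
    1# * b         ≈⟨ *-congʳ (sym (trans (*-comm u⁻¹ u) uu⁻¹≈1)) ⟩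
    (u⁻¹ * u) * b  ≈⟨ *-assoc u⁻¹ u b ⟩
    u⁻¹ * (u * b)  ≈⟨ *-congˡ (sym a≈ub) ⟩
    u⁻¹ * a        ∎)

  associated-by-units : ∀ {s v x y} → IsUnit R s → IsUnit R v → s * x ≈ v * y → Associated R x y
  associated-by-units {s} {v} {x} {y} (s⁻¹ , ss⁻¹≈1) vU sx≈vy = s⁻¹ * v , *-unit (inverse-unit ss⁻¹≈1) vU , (begin
    x                ≈⟨ sym (*-identityˡ x) ⟩
    1# * x           ≈⟨ *-congʳ (sym (trans (*-comm s⁻¹ s) ss⁻¹≈1)) ⟩
    (s⁻¹ * s) * x    ≈⟨ *-assoc s⁻¹ s x ⟩
    s⁻¹ * (s * x)    ≈⟨ *-congˡ sx≈vy ⟩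
    s⁻¹ * (v * y)    ≈⟨ sym (*-assoc s⁻¹ v y) ⟩
    (s⁻¹ * v) * y    ∎)

  associated-*-unit : ∀ {a b w} → Associated R a b → IsUnit R w → Associated R (a * w) b
  associated-*-unit {a} {b} {w} (u , uU , a≈ub) wU = u * w , *-unit uU wU , (begin
    a * w         ≈⟨ *-congʳ a≈ub ⟩
    (u * b) * w   ≈⟨ x*y*z≈x*z*y u b w ⟩
    (u * w) * b   ∎)
    where
    x*y*z≈x*z*y : ∀ x y z → (x * y) * z ≈ (x * z) * y
    x*y*z≈x*z*y = solve 3 (λ x y z → (x :* y) :* z := (x :* z) :* y) refl

  associated-prod : ∀ {xs ys} → Pointwise (Associated R) xs ys → Associated R (prod R xs) (prod R ys)
  associated-prod []                      = 1# , 1-unit , sym (*-identityˡ 1#)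
  associated-prod {x ∷ xs} {y ∷ ys} ((u , uU , x≈uy) ∷ rest)
    with v , vU , xs≈vys ← associated-prod rest = u * v , *-unit uU vU , (begin
      x * prod R xs             ≈⟨ *-cong x≈uy xs≈vys ⟩
      (u * y) * (v * prod R ys) ≈⟨ interchange u y v (prod R ys) ⟩
      (u * v) * (y * prod R ys) ∎)

-- Nonzero elements of an integral domain.
module DomainFacts {c ℓ} (R : CommutativeRing c ℓ) (dom : IsIntegralDomain R) where
  open CommutativeRing R hiding (zero)
  open RingFacts R
  open import Algebra.Properties.Group +-group using (x≈y⇒x∙y⁻¹≈ε; x∙y⁻¹≈ε⇒x≈y)
  open import Algebra.Properties.Ring ring using ([y-z]x≈yx-zx)
  open import Relation.Binary.Reasoning.Setoid setoid

  1≉0 : ¬ 1# ≈ 0#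
  1≉0 = proj₁ dom

  zero-productʳ : ∀ {a b} → ¬ a ≈ 0# → a * b ≈ 0# → b ≈ 0#
  zero-productʳ {a} {b} a≉0 ab≈0 with proj₂ dom a b ab≈0
  ... | inj₁ a≈0 = contradiction a≈0 a≉0
  ... | inj₂ b≈0 = b≈0

  zero-productˡ : ∀ {a b} → ¬ b ≈ 0# → a * b ≈ 0# → a ≈ 0#
  zero-productˡ {a} {b} b≉0 ab≈0 = zero-productʳ b≉0 (trans (*-comm b a) ab≈0)

  *-nonzero : ∀ {a b} → ¬ a ≈ 0# → ¬ b ≈ 0# → ¬ a * b ≈ 0#
  *-nonzero a≉0 b≉0 ab≈0 = b≉0 (zero-productʳ a≉0 ab≈0)

  ^-nonzero : ∀ {a} n → ¬ a ≈ 0# → ¬ a ^ n ≈ 0#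
  ^-nonzero zero    _   = 1≉0
  ^-nonzero (suc n) a≉0 = *-nonzero a≉0 (^-nonzero n a≉0)

  unit-nonzero : ∀ {u} → IsUnit R u → ¬ u ≈ 0#
  unit-nonzero {u} (u⁻¹ , uu⁻¹≈1) u≈0 = 1≉0 (begin
    1#        ≈⟨ sym uu⁻¹≈1 ⟩
    u * u⁻¹   ≈⟨ *-congʳ u≈0 ⟩
    0# * u⁻¹  ≈⟨ zeroˡ u⁻¹ ⟩
    0#        ∎)

  prod-irreducible-nonzero : ∀ {xs} → All (Irreducible R) xs → ¬ prod R xs ≈ 0#
  prod-irreducible-nonzero []         = 1≉0
  prod-irreducible-nonzero (px ∷ pxs) = *-nonzero (proj₁ px) (prod-irreducible-nonzero pxs)

  *-cancelʳ : ∀ {a x y} → ¬ a ≈ 0# → x * a ≈ y * a → x ≈ y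
  *-cancelʳ {a} {x} {y} a≉0 xa≈ya = x∙y⁻¹≈ε⇒x≈y x y (zero-productˡ a≉0 (begin
    (x - y) * a     ≈⟨ [y-z]x≈yx-zx a x y ⟩
    x * a - y * a   ≈⟨ x≈y⇒x∙y⁻¹≈ε xa≈ya ⟩
    0#              ∎))

-- Polynomials over the fraction field with denominators cleared; the rational root test.
module ClearedDenominators {c ℓ} (R : CommutativeRing c ℓ) (dom : IsIntegralDomain R) where
  open CommutativeRing R hiding (zero)
  open RingFacts R
  open DomainFacts R dom
  open FracOps R dom
  open import Algebra.Solver.Ring.NaturalCoefficients.Default commutativeSemiring
  open import Relation.Binary.Reasoning.Setoid setoid

  denProd : ∀ {k} → (Fin k → Frac R) → Carrier
  denProd {zero}  cs = 1#
  denProd {suc k} cs = den (head cs) * denProd (tail cs)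

  denProd-nonzero : ∀ {k} (cs : Fin k → Frac R) → ¬ denProd cs ≈ 0#
  denProd-nonzero {zero}  cs = 1≉0
  denProd-nonzero {suc k} cs = *-nonzero (den≉0 (head cs)) (denProd-nonzero (tail cs))

  denProd-cong : ∀ {k} (cs ds : Fin k → Frac R) → (∀ j → den (cs j) ≡ den (ds j)) →
                 denProd cs ≡ denProd ds
  denProd-cong {zero}  cs ds same = ≡.refl
  denProd-cong {suc k} cs ds same =
    ≡.cong₂ _*_ (same zero) (denProd-cong (tail cs) (tail ds) (λ j → same (suc j)))

  -- For f = Σ cs_j x^j of degree k, `cleared cs p q` is q^k · denProd cs · f(p/q),
  -- an element of R: the value of f at p/q with all denominators cleared.
  cleared : ∀ {k} → (Fin (suc k) → Frac R) → Carrier → Carrier → Carrier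
  cleared {zero}  cs p q = num (head cs)
  cleared {suc k} cs p q =
    num (head cs) * (denProd (tail cs) * q ^ suc k) + (p * cleared (tail cs) p q) * den (head cs)

  lowCoeff : ∀ {k} → (Fin (suc k) → Frac R) → Carrier
  lowCoeff cs = num (head cs) * denProd (tail cs)

  highCoeff : ∀ {k} → (Fin (suc k) → Frac R) → Carrier
  highCoeff cs = num (last cs) * denProd (init cs)

  den-evalK : ∀ {k} (cs : Fin k → Frac R) z → den (evalK cs z) ≈ denProd cs * den z ^ k
  den-evalK {zero}  cs z = sym (*-identityˡ 1#)
  den-evalK {suc k} cs z = begin
    d₀ * (den z * den (evalK (tail cs) z))          ≈⟨ *-congˡ (*-congˡ (den-evalK (tail cs) z)) ⟩
    d₀ * (den z * (denProd (tail cs) * den z ^ k))  ≈⟨ reorder d₀ (den z) (denProd (tail cs)) (den z ^ k) ⟩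
    (d₀ * denProd (tail cs)) * (den z * den z ^ k)  ∎
    where
    d₀ = den (head cs)
    reorder : ∀ a b c d → a * (b * (c * d)) ≈ (a * c) * (b * d)
    reorder = solve 4 (λ a b c d → a :* (b :* (c :* d)) := (a :* c) :* (b :* d)) refl

  num-evalK : ∀ {k} (cs : Fin (suc k) → Frac R) z →
              num (evalK cs z) ≈ den z * cleared cs (num z) (den z)
  num-evalK {zero} cs z = reorder (num (head cs)) (den z) (num z) (den (head cs))
    where
    reorder : ∀ a b c d → a * (b * 1#) + (c * 0#) * d ≈ b * a
    reorder = solve 4 (λ a b c d → a :* (b :* con 1) :+ (c :* con 0) :* d := b :* a) refl
  num-evalK {suc k} cs z = begin
    n₀ * (m * den (evalK (tail cs) z)) + (n * num (evalK (tail cs) z)) * d₀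
      ≈⟨ +-cong (*-congˡ (*-congˡ (den-evalK (tail cs) z))) (*-congʳ (*-congˡ (num-evalK (tail cs) z))) ⟩
    n₀ * (m * (D * m ^ suc k)) + (n * (m * G)) * d₀
      ≈⟨ reorder n₀ m D (m ^ suc k) n G d₀ ⟩
    m * (n₀ * (D * m ^ suc k) + (n * G) * d₀)
      ∎
    where
    n₀ = num (head cs)
    d₀ = den (head cs)
    n = num z
    m = den z
    D = denProd (tail cs)
    G = cleared (tail cs) n m
    reorder : ∀ a b c d e f g → a * (b * (c * d)) + (e * (b * f)) * g ≈ b * (a * (c * d) + (e * f) * g)
    reorder = solve 7 (λ a b c d e f g →
      a :* (b :* (c :* d)) :+ (e :* (b :* f)) :* g := b :* (a :* (c :* d) :+ (e :* f) :* g)) refl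

  cleared-rescale : ∀ {k} (cs : Fin (suc k) → Frac R) n m p q → n * q ≈ p * m →
                    cleared cs n m * q ^ k ≈ cleared cs p q * m ^ k
  cleared-rescale {zero}  cs n m p q nq≈pm = refl
  cleared-rescale {suc k} cs n m p q nq≈pm = begin
    (n₀ * (D * (m * M)) + (n * cleared (tail cs) n m) * d₀) * (q * Q)
      ≈⟨ expand n₀ D m M n (cleared (tail cs) n m) d₀ q Q ⟩
    n₀ * D * (m * M) * (q * Q) + (n * q) * d₀ * (cleared (tail cs) n m * Q)
      ≈⟨ +-congˡ (*-cong (*-congʳ nq≈pm) (cleared-rescale (tail cs) n m p q nq≈pm)) ⟩
    n₀ * D * (m * M) * (q * Q) + (p * m) * d₀ * (cleared (tail cs) p q * M)
      ≈⟨ collect n₀ D m M p (cleared (tail cs) p q) d₀ q Q ⟩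
    (n₀ * (D * (q * Q)) + (p * cleared (tail cs) p q) * d₀) * (m * M)
      ∎
    where
    n₀ = num (head cs)
    d₀ = den (head cs)
    D = denProd (tail cs)
    M = m ^ k
    Q = q ^ k
    expand : ∀ a b c d e f g h i →
      (a * (b * (c * d)) + (e * f) * g) * (h * i) ≈ a * b * (c * d) * (h * i) + (e * h) * g * (f * i)
    expand = solve 9 (λ a b c d e f g h i →
      (a :* (b :* (c :* d)) :+ (e :* f) :* g) :* (h :* i) := a :* b :* (c :* d) :* (h :* i) :+ (e :* h) :* g :* (f :* i)) refl
    collect : ∀ a b c d e f g h i →
      a * b * (c * d) * (h * i) + (e * c) * g * (f * d) ≈ (a * (b * (h * i)) + (e * f) * g) * (c * d)
    collect = solve 9 (λ a b c d e f g h i →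
      a :* b :* (c :* d) :* (h :* i) :+ (e :* c) :* g :* (f :* d) := (a :* (b :* (h :* i)) :+ (e :* f) :* g) :* (c :* d)) refl

  cleared-low : ∀ {k} (cs : Fin (suc (suc k)) → Frac R) p q →
                ∃ λ t → cleared cs p q ≈ lowCoeff cs * q ^ suc k + p * t
  cleared-low cs p q = cleared (tail cs) p q * den (head cs) , reorder _ _ _ _ _ _
    where
    reorder : ∀ a b c e f g → a * (b * c) + (e * f) * g ≈ (a * b) * c + e * (f * g)
    reorder = solve 6 (λ a b c e f g → a :* (b :* c) :+ (e :* f) :* g := (a :* b) :* c :+ e :* (f :* g)) refl

  cleared-high : ∀ {k} (cs : Fin (suc k) → Frac R) p q →
                 ∃ λ t → cleared cs p q ≈ highCoeff cs * p ^ k + q * t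
  cleared-high {zero} cs p q = 0# , reorder (num (head cs)) q
    where
    reorder : ∀ a q → a ≈ (a * 1#) * 1# + q * 0#
    reorder = solve 2 (λ a q → a := (a :* con 1) :* con 1 :+ q :* con 0) refl
  cleared-high {suc k} cs p q with t , G≈ ← cleared-high (tail cs) p q =
    n₀ * (D * Q) + (p * t) * d₀ , (begin
      n₀ * (D * (q * Q)) + (p * cleared (tail cs) p q) * d₀
        ≈⟨ +-congˡ (*-congʳ (*-congˡ G≈)) ⟩
      n₀ * (D * (q * Q)) + (p * ((A * I) * P + q * t)) * d₀
        ≈⟨ reorder n₀ D q Q p A I P t d₀ ⟩
      (A * (d₀ * I)) * (p * P) + q * (n₀ * (D * Q) + (p * t) * d₀)
        ∎)
    where
    n₀ = num (head cs)
    d₀ = den (head cs)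
    D = denProd (tail cs)
    Q = q ^ k
    P = p ^ k
    A = num (last cs)
    I = denProd (init (tail cs))
    reorder : ∀ a b q Q p A I P t d →
      a * (b * (q * Q)) + (p * ((A * I) * P + q * t)) * d ≈ (A * (d * I)) * (p * P) + q * (a * (b * Q) + (p * t) * d)
    reorder = solve 10 (λ a b q Q p A I P t d →
      a :* (b :* (q :* Q)) :+ (p :* ((A :* I) :* P :+ q :* t)) :* d := (A :* (d :* I)) :* (p :* P) :+ q :* (a :* (b :* Q) :+ (p :* t) :* d)) refl

  cleared-root : ∀ {k} (cs : Fin (suc k) → Frac R) z → evalK cs z ≈K 0K →
                 ∀ p q → num z * q ≈ p * den z → cleared cs p q ≈ 0#
  cleared-root {k} cs z root p q nq≈pm =
    zero-productˡ (^-nonzero k (den≉0 z)) (begin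
      cleared cs p q * den z ^ k            ≈⟨ sym (cleared-rescale cs (num z) (den z) p q nq≈pm) ⟩
      cleared cs (num z) (den z) * q ^ k    ≈⟨ *-congʳ vanishes-at-z ⟩
      0# * q ^ k                            ≈⟨ zeroˡ (q ^ k) ⟩
      0#                                    ∎)
    where
    vanishes-at-z : cleared cs (num z) (den z) ≈ 0#
    vanishes-at-z = zero-productʳ (den≉0 z) (begin
      den z * cleared cs (num z) (den z)    ≈⟨ sym (num-evalK cs z) ⟩
      num (evalK cs z)                      ≈⟨ sym (*-identityʳ _) ⟩
      num (evalK cs z) * 1#                 ≈⟨ root ⟩
      0# * den (evalK cs z)                 ≈⟨ zeroˡ _ ⟩
      0#                                    ∎)

  rational-root-test : ∀ {k} (cs : Fin (suc (suc k)) → Frac R) z → evalK cs z ≈K 0K →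
    ∀ p q → num z * q ≈ p * den z →
    p ∣ lowCoeff cs * q ^ suc k × q ∣ highCoeff cs * p ^ suc k
  rational-root-test cs z root p q nq≈pm =
    sum≈0⇒∣ (trans (sym (proj₂ (cleared-low cs p q))) vanishes) ,
    sum≈0⇒∣ (trans (sym (proj₂ (cleared-high cs p q))) vanishes)
    where
    vanishes : cleared cs p q ≈ 0#
    vanishes = cleared-root cs z root p q nq≈pm

  *K-nonzero : ∀ x y → ¬ x *K y ≈K 0K → ¬ num x ≈ 0# × ¬ num y ≈ 0#
  *K-nonzero x y xy≉0 = (λ nx≈0 → xy≉0 (vanishes (trans (*-congʳ nx≈0) (zeroˡ _))))
                      , (λ ny≈0 → xy≉0 (vanishes (trans (*-congˡ ny≈0) (zeroʳ _))))
    where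
    vanishes : num x * num y ≈ 0# → x *K y ≈K 0K
    vanishes nxy≈0 = trans (*-identityʳ _) (trans nxy≈0 (sym (zeroˡ _)))

  -- `setCoeff a i x` differs from a only at i, where the denominator is 1# whatever x is.
  setCoeff-other : ∀ {n} (a : Fin n → Frac R) i x {j} → j ≢ i → setCoeff a i x j ≡ a j
  setCoeff-other a i x {j} j≢i with j Fin.≟ i
  ... | yes j≡i = contradiction j≡i j≢i
  ... | no  _   = ≡.refl

  den-setCoeff : ∀ {n} (a : Fin n → Frac R) i x y j → den (setCoeff a i x j) ≡ den (setCoeff a i y j)
  den-setCoeff a i x y j with j Fin.≟ i
  ... | yes _ = ≡.refl
  ... | no  _ = ≡.refl

  lowCoeff-setCoeff : ∀ {k} (a : Fin (suc k) → Frac R) i x → zero ≢ i →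
                      lowCoeff (setCoeff a i x) ≡ num (head a) * denProd (tail (setCoeff a i 0#))
  lowCoeff-setCoeff a i x 0≢i =
    ≡.cong₂ _*_ (≡.cong num (setCoeff-other a i x 0≢i))
                (denProd-cong _ _ (λ j → den-setCoeff a i x 0# (suc j)))

  highCoeff-setCoeff : ∀ {k} (a : Fin (suc k) → Frac R) i x → fromℕ k ≢ i →
                       highCoeff (setCoeff a i x) ≡ num (last a) * denProd (init (setCoeff a i 0#))
  highCoeff-setCoeff {k} a i x last≢i =
    ≡.cong₂ _*_ (≡.cong num (setCoeff-other a i x last≢i))
                (denProd-cong _ _ (λ j → den-setCoeff a i x 0# (Fin.inject₁ j)))

-- Unique factorisation: coprime division, lowest terms, and the finite set of candidates.
module Factorisation {c ℓ} (R : CommutativeRing c ℓ) (ufd : IsUFD R) where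
  open CommutativeRing R hiding (zero)
  open IsUFD ufd
  open RingFacts R
  open DomainFacts R isIntegralDomain
  open FracOps R isIntegralDomain
  open ClearedDenominators R isIntegralDomain
  open import Algebra.Properties.Semigroup.Divisibility *-semigroup using (∣ʳ-trans; ∣ʳ-respʳ-≈; x∣ʳyx)
  open import Algebra.Solver.Ring.NaturalCoefficients.Default commutativeSemiring
  open import Relation.Binary.Reasoning.Setoid setoid

  factorise : ∀ a → ¬ a ≈ 0# → ∃ λ B → All (Irreducible R) B × Associated R a (prod R B)
  factorise a a≉0 with v , B , vU , iB , a≈vB ← factor a a≉0 = B , iB , v , vU , a≈vB

  associated-irreducibles-nonzero : ∀ {a B} → All (Irreducible R) B → Associated R a (prod R B) → ¬ a ≈ 0#
  associated-irreducibles-nonzero iB (v , vU , a≈vB) a≈0 =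
    *-nonzero (unit-nonzero vU) (prod-irreducible-nonzero iB) (trans (sym a≈vB) a≈0)

  CommonFactor : List Carrier → List Carrier → Set (c ⊔ ℓ)
  CommonFactor U V = ∃₂ λ π x → π ∈ U × x ∈ V × Associated R π x

  AssociatedSubBag : List Carrier → List Carrier → Set (c ⊔ ℓ)
  AssociatedSubBag U B = ∃₂ λ X B′ → Pointwise (Associated R) U X × X ++ B′ ↭ B

  -- Comparing the factorisations U ++ (cofactor) and
  -- B ++ d·V shows that either U and V share an irreducible factor, or U is, up to
  -- associates, a sub-multiset of B.
  coprime-division : ∀ d {A U V B} →
    All (Irreducible R) U → All (Irreducible R) V → All (Irreducible R) B →
    Associated R A (prod R B) → prod R U ∣ A * prod R V ^ d →
    CommonFactor U V ⊎ AssociatedSubBag U B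
  coprime-division d {A} {U} {V} {B} iU iV iB A~B@(v , vU , A≈vB) (divides S S∏U≈A∏Vᵈ) =
    compare (factor S S≉0)
    where
    S≉0 : ¬ S ≈ 0#
    S≉0 S≈0 = *-nonzero (associated-irreducibles-nonzero iB A~B)
                        (^-nonzero d (prod-irreducible-nonzero iV))
                        (trans (sym S∏U≈A∏Vᵈ) (trans (*-congʳ S≈0) (zeroˡ _)))

    -- Both U ++ Ss and B ++ d·V factor (up to units) the element S·∏U = A·(∏V)^d.
    same-product : ∀ s Ss → S ≈ s * prod R Ss → s * prod R (U ++ Ss) ≈ v * prod R (B ++ copies d V)
    same-product s Ss S≈sSs = begin
      s * prod R (U ++ Ss)                 ≈⟨ *-congˡ (prod-++ U Ss) ⟩
      s * (prod R U * prod R Ss)           ≈⟨ x*[y*z]≈[x*z]*y s (prod R U) (prod R Ss) ⟩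
      (s * prod R Ss) * prod R U           ≈⟨ *-congʳ (sym S≈sSs) ⟩
      S * prod R U                         ≈⟨ S∏U≈A∏Vᵈ ⟩
      A * prod R V ^ d                     ≈⟨ *-cong A≈vB (sym (prod-copies d V)) ⟩
      (v * prod R B) * prod R (copies d V) ≈⟨ *-assoc v _ _ ⟩
      v * (prod R B * prod R (copies d V)) ≈⟨ *-congˡ (sym (prod-++ B (copies d V))) ⟩
      v * prod R (B ++ copies d V)         ∎
      where
      x*[y*z]≈[x*z]*y : ∀ x y z → x * (y * z) ≈ (x * z) * y
      x*[y*z]≈[x*z]*y = solve 3 (λ x y z → x :* (y :* z) := (x :* z) :* y) refl

    compare : (∃ λ s → ∃ λ Ss → IsUnit R s × All (Irreducible R) Ss × S ≈ s * prod R Ss) →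
              CommonFactor U V ⊎ AssociatedSubBag U B
    compare (s , Ss , sU , iSs , S≈sSs)
      with X₁₂ , B++Vᵈ↭X₁₂ , U++Ss~X₁₂ ← unique (U ++ Ss) (B ++ copies d V)
             (All.++⁺ iU iSs) (All.++⁺ iB (All-copies d iV))
             (associated-by-units sU vU (same-product s Ss S≈sSs))
      with X , X₂ , ≡.refl , U~X ← pointwise-++⁻ U U++Ss~X₁₂
      with meets-or-sub X (↭-sym B++Vᵈ↭X₁₂)
    ... | inj₂ (B′ , X++B′↭B) = inj₂ (X , B′ , U~X , X++B′↭B)
    ... | inj₁ (x , x∈X , x∈Vᵈ) with π , π∈U , π~x ← pointwise-∈ U~X x∈X =
      inj₁ (π , x , π∈U , ∈-copies⁻ d x∈Vᵈ , π~x)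

  record FactoredAs (z : Frac R) (u : Carrier) (Ps Qs : List Carrier) : Set (c ⊔ ℓ) where
    constructor factoredAs
    field
      unit       : IsUnit R u
      numerator  : All (Irreducible R) Ps
      denominator : All (Irreducible R) Qs
      equation   : num z * prod R Qs ≈ (u * prod R Ps) * den z

  factored : ∀ z → ¬ num z ≈ 0# → ∃ λ u → ∃₂ λ Ps Qs → FactoredAs z u Ps Qs
  factored z n≉0
    with u₁ , Ps , u₁U , iPs , n≈u₁Ps ← factor (num z) n≉0
       | u₂ , Qs , u₂U , iQs , m≈u₂Qs ← factor (den z) (den≉0 z)
    with u₂′ , u₂′U , Qs≈u₂′m ← associated-sym (u₂ , u₂U , m≈u₂Qs) =
    u₁ * u₂′ , Ps , Qs , factoredAs (*-unit u₁U u₂′U) iPs iQs (begin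
      num z * prod R Qs              ≈⟨ *-cong n≈u₁Ps Qs≈u₂′m ⟩
      (u₁ * prod R Ps) * (u₂′ * den z) ≈⟨ regroup u₁ (prod R Ps) u₂′ (den z) ⟩
      ((u₁ * u₂′) * prod R Ps) * den z ∎)
    where
    regroup : ∀ a b c d → (a * b) * (c * d) ≈ ((a * c) * b) * d
    regroup = solve 4 (λ a b c d → (a :* b) :* (c :* d) := ((a :* c) :* b) :* d) refl

  cancel-common : ∀ {z u Ps Qs} → FactoredAs z u Ps Qs → CommonFactor Ps Qs →
    ∃ λ u′ → ∃₂ λ Ps′ Qs′ → FactoredAs z u′ Ps′ Qs′ × length Ps ≡ suc (length Ps′)
  cancel-common {z} {u} {Ps} {Qs} (factoredAs uU iPs iQs rel) (π , x , π∈Ps , x∈Qs , (e , eU , π≈ex))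
    with Ps′ , Ps↭ ← extract π∈Ps | Qs′ , Qs↭ ← extract x∈Qs =
    u * e , Ps′ , Qs′ , factoredAs (*-unit uU eU) (irreducible-rest Ps↭ iPs) (irreducible-rest Qs↭ iQs)
    (*-cancelʳ (proj₁ (All.lookup iQs x∈Qs)) (begin
      (num z * prod R Qs′) * x            ≈⟨ x*y*z≈x*[z*y] (num z) (prod R Qs′) x ⟩
      num z * (x * prod R Qs′)            ≈⟨ *-congˡ (sym (prod-↭ Qs↭)) ⟩
      num z * prod R Qs                   ≈⟨ rel ⟩
      (u * prod R Ps) * den z             ≈⟨ *-congʳ (*-congˡ (prod-↭ Ps↭)) ⟩
      (u * (π * prod R Ps′)) * den z      ≈⟨ *-congʳ (*-congˡ (*-congʳ π≈ex)) ⟩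
      (u * ((e * x) * prod R Ps′)) * den z ≈⟨ regroup u e x (prod R Ps′) (den z) ⟩
      ((u * e) * prod R Ps′ * den z) * x  ∎)) ,
    ↭-length Ps↭
    where
    irreducible-rest : ∀ {y ys Ys} → Ys ↭ y ∷ ys → All (Irreducible R) Ys → All (Irreducible R) ys
    irreducible-rest Ys↭ iYs = All.tail (All-resp-↭ Ys↭ iYs)
    x*y*z≈x*[z*y] : ∀ x y z → (x * y) * z ≈ x * (z * y)
    x*y*z≈x*[z*y] = solve 3 (λ x y z → (x :* y) :* z := x :* (z :* y)) refl
    regroup : ∀ a b c d f → (a * ((b * c) * d)) * f ≈ ((a * b) * d * f) * c
    regroup = solve 5 (λ a b c d f → (a :* ((b :* c) :* d)) :* f := ((a :* b) :* d :* f) :* c) refl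

  -- Irreducible factors cannot be compared decidably, so instead: if every
  -- factored representation of z either exhibits a common factor or establishes Goal, then
  -- Goal holds.  (Cancel common factors until none is exhibited.)
  lowest-terms : ∀ {g} (Goal : Set g) z → ¬ num z ≈ 0# →
    (∀ {u Ps Qs} → FactoredAs z u Ps Qs → CommonFactor Ps Qs ⊎ Goal) → Goal
  lowest-terms Goal z n≉0 test with _ , Ps , _ , fac ← factored z n≉0 = descend (length Ps) ≡.refl fac
    where
    descend : ∀ n {u Ps Qs} → length Ps ≡ n → FactoredAs z u Ps Qs → Goal
    shorten : ∀ n {Ps} → length Ps ≡ n →
              (∃ λ u′ → ∃₂ λ Ps′ Qs′ → FactoredAs z u′ Ps′ Qs′ × length Ps ≡ suc (length Ps′)) → Goal

    descend n {u} {Ps} {Qs} len fac with test fac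
    ... | inj₂ goal   = goal
    ... | inj₁ common = shorten n {Ps} len (cancel-common {z} {u} {Ps} {Qs} fac common)

    shorten zero    len (_ , _ , _ , _    , longer) = contradiction (≡.trans (≡.sym longer) len) 1+n≢0
    shorten (suc n) len (_ , _ , _ , fac′ , longer) = descend n (suc-injective (≡.trans (≡.sym longer) len)) fac′

  UnitMultipleOf : Frac R → List (Frac R) → Set (c ⊔ ℓ)
  UnitMultipleOf z ys = ∃ λ y → y ∈ ys × (¬ y ≈K 0K) × ∃ λ u → IsUnit R u × (z ≈K ι u *K y)

  candidate : ∀ {Bᵈ} → All (Irreducible R) Bᵈ → List Carrier → List Carrier → Frac R
  candidate {Bᵈ} iBᵈ X W = (prod R X * prod R W) / prod R Bᵈ [ prod-irreducible-nonzero iBᵈ ]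

  candidates : ∀ B₀ {Bᵈ} → All (Irreducible R) Bᵈ → List (Frac R)
  candidates B₀ {Bᵈ} iBᵈ = cartesianProductWith (candidate iBᵈ) (subBags B₀) (subBags Bᵈ)

  -- If z = u·∏Ps/∏Qs where Ps and Qs are, up to associates, sub-multisets of B₀ and Bᵈ,
  -- then z is a unit multiple of a candidate: ∏Ps/∏Qs ~ ∏X/∏Y = ∏X·∏W/∏Bᵈ for Y ++ W ↭ Bᵈ.
  subBag-candidate : ∀ {z u Ps Qs B₀ Bᵈ} → All (Irreducible R) B₀ → (iBᵈ : All (Irreducible R) Bᵈ) →
    FactoredAs z u Ps Qs → AssociatedSubBag Ps B₀ → AssociatedSubBag Qs Bᵈ →
    UnitMultipleOf z (candidates B₀ iBᵈ)
  subBag-candidate {z} {u} {Ps} {Qs} {B₀} {Bᵈ} iB₀ iBᵈ (factoredAs uU _ _ rel) (X , X′ , Ps~X , X↭) (Y , W , Qs~Y , Y↭)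
    with e₁ , e₁U , Ps≈e₁X ← associated-prod Ps~X
       | e₂ , e₂U , Y≈e₂Qs ← associated-sym (associated-prod Qs~Y) =
    candidate iBᵈ X W ,
    ∈-cartesianProductWith⁺ (candidate iBᵈ) {a = X} {b = W} (∈-subBags {X = X} X↭) (∈-subBags {X = W} (↭-trans (++-comm W Y) Y↭)) ,
    candidate≉0 ,
    e₂ * (u * e₁) , *-unit e₂U (*-unit uU e₁U) , (begin
      num z * (1# * prod R Bᵈ)                          ≈⟨ *-congˡ (*-identityˡ _) ⟩
      num z * prod R Bᵈ                                 ≈⟨ *-congˡ (sym (prod-↭ Y↭)) ⟩
      num z * prod R (Y ++ W)                           ≈⟨ *-congˡ (prod-++ Y W) ⟩
      num z * (prod R Y * prod R W)                     ≈⟨ *-congˡ (*-congʳ Y≈e₂Qs) ⟩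
      num z * ((e₂ * prod R Qs) * prod R W)             ≈⟨ pull-out e₂ (num z) (prod R Qs) (prod R W) ⟩
      e₂ * ((num z * prod R Qs) * prod R W)             ≈⟨ *-congˡ (*-congʳ rel) ⟩
      e₂ * (((u * prod R Ps) * den z) * prod R W)       ≈⟨ *-congˡ (*-congʳ (*-congʳ (*-congˡ Ps≈e₁X))) ⟩
      e₂ * (((u * (e₁ * prod R X)) * den z) * prod R W) ≈⟨ regroup e₂ u e₁ (prod R X) (den z) (prod R W) ⟩
      ((e₂ * (u * e₁)) * (prod R X * prod R W)) * den z ∎)
    where
    iX : All (Irreducible R) X
    iX = All.++⁻ˡ X (All-resp-↭ (↭-sym X↭) iB₀)
    iW : All (Irreducible R) W
    iW = All.++⁻ʳ Y (All-resp-↭ (↭-sym Y↭) iBᵈ)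
    candidate≉0 : ¬ candidate iBᵈ X W ≈K 0K
    candidate≉0 XW≈0 = *-nonzero (prod-irreducible-nonzero iX) (prod-irreducible-nonzero iW)
                         (trans (sym (*-identityʳ _)) (trans XW≈0 (zeroˡ _)))
    pull-out : ∀ a b c d → b * ((a * c) * d) ≈ a * ((b * c) * d)
    pull-out = solve 4 (λ a b c d → b :* ((a :* c) :* d) := a :* ((b :* c) :* d)) refl
    regroup : ∀ a b c d e f → a * (((b * (c * d)) * e) * f) ≈ ((a * (b * c)) * (d * f)) * e
    regroup = solve 6 (λ a b c d e f → a :* (((b :* (c :* d)) :* e) :* f) := ((a :* (b :* c)) :* (d :* f)) :* e) refl

  -- Every root z of f is a unit multiple of a candidate: write z
  -- in lowest terms u·∏Ps/∏Qs; by the rational root test and coprime division, Ps is a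
  -- sub-multiset of B₀ and Qs one of Bᵈ (up to associates), unless a common factor remains.
  roots-are-candidates : ∀ {k} (cs : Fin (suc (suc k)) → Frac R) {B₀ Bᵈ} →
    All (Irreducible R) B₀ → (iBᵈ : All (Irreducible R) Bᵈ) →
    Associated R (lowCoeff cs) (prod R B₀) → Associated R (highCoeff cs) (prod R Bᵈ) →
    ∀ z → evalK cs z ≈K 0K → UnitMultipleOf z (candidates B₀ iBᵈ)
  roots-are-candidates {k} cs {B₀} {Bᵈ} iB₀ iBᵈ low~B₀ high~Bᵈ z root =
    lowest-terms _ z num≉0 reduce
    where
    num≉0 : ¬ num z ≈ 0#
    num≉0 n≈0 = no-zero-divisor (proj₁ (rational-root-test cs z root (num z) (den z) refl))
      where
      no-zero-divisor : num z ∣ lowCoeff cs * den z ^ suc k → ⊥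
      no-zero-divisor (divides t tn≈low) =
        *-nonzero (associated-irreducibles-nonzero iB₀ low~B₀) (^-nonzero (suc k) (den≉0 z))
                  (trans (sym tn≈low) (trans (*-congˡ n≈0) (zeroʳ t)))

    split-power : ∀ a u p → a * (u * p) ^ suc k ≈ (a * u ^ suc k) * p ^ suc k
    split-power a u p = trans (*-congˡ (^-distrib-* u p (suc k))) (sym (*-assoc a _ _))

    combine : ∀ {u Ps Qs} → FactoredAs z u Ps Qs →
              CommonFactor Ps Qs ⊎ AssociatedSubBag Ps B₀ → CommonFactor Qs Ps ⊎ AssociatedSubBag Qs Bᵈ →
              CommonFactor Ps Qs ⊎ UnitMultipleOf z (candidates B₀ iBᵈ)
    combine _   (inj₁ common) _ = inj₁ common
    combine _   (inj₂ _) (inj₁ (x , π , x∈Qs , π∈Ps , x~π)) = inj₁ (π , x , π∈Ps , x∈Qs , associated-sym x~π)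
    combine fac (inj₂ Ps≲B₀) (inj₂ Qs≲Bᵈ) = inj₂ (subBag-candidate iB₀ iBᵈ fac Ps≲B₀ Qs≲Bᵈ)

    reduce : ∀ {u Ps Qs} → FactoredAs z u Ps Qs → CommonFactor Ps Qs ⊎ UnitMultipleOf z (candidates B₀ iBᵈ)
    reduce {u} {Ps} {Qs} fac@(factoredAs uU iPs iQs rel) = combine fac
      (coprime-division (suc k) iPs iQs iB₀ low~B₀ (∣ʳ-trans (x∣ʳyx (prod R Ps) u) (proj₁ divisibility)))
      (coprime-division (suc k) iQs iPs iBᵈ (associated-*-unit high~Bᵈ (^-unit (suc k) uU))
                        (∣ʳ-respʳ-≈ (split-power (highCoeff cs) u (prod R Ps)) (proj₂ divisibility)))
      where
      divisibility : u * prod R Ps ∣ lowCoeff cs * prod R Qs ^ suc k ×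
                     prod R Qs ∣ highCoeff cs * (u * prod R Ps) ^ suc k
      divisibility = rational-root-test cs z root (u * prod R Ps) (prod R Qs) rel

-- Lemma 5.4.  The constant and leading coefficients, with the other denominators cleared,
-- do not depend on the inner coefficient aᵢ ∈ R; factor them as ∏B₀ and ∏Bᵈ, and take
-- the candidates built from B₀ and Bᵈ.

lemma5p4 : ∀ {c ℓ} (R : CommutativeRing c ℓ) (ufd : IsUFD R) →
    let open CommutativeRing R using (Carrier)
        open FracOps R (IsUFD.isIntegralDomain ufd)
    in (d : ℕ) → 2 ≤ d → (i : Fin (suc d)) → 0 < toℕ i → toℕ i < d →
       (a : Fin (suc d) → Frac R) →
       ¬ (a zero *K a (fromℕ d) ≈K 0K) →
       ∃ λ (ys : List (Frac R)) →
         (aᵢ : Carrier) (z : Frac R) →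
         evalK (setCoeff a i aᵢ) z ≈K 0K →
         ∃ λ y → y ∈ ys × (¬ y ≈K 0K) × ∃ λ u → IsUnit R u × (z ≈K ι u *K y)
lemma5p4 R ufd d@(suc (suc _)) (s≤s (s≤s _)) i 0<i i<d a a₀aᵈ≉0 =
  let B₀ , iB₀ , A₀~B₀ = factorise A₀ A₀≉0
      Bᵈ , iBᵈ , Aᵈ~Bᵈ = factorise Aᵈ Aᵈ≉0
  in candidates B₀ iBᵈ , λ aᵢ z root →
       roots-are-candidates (setCoeff a i aᵢ) iB₀ iBᵈ
         (≡.subst (λ A → Associated R A (prod R B₀)) (≡.sym (lowCoeff-setCoeff a i aᵢ 0≢i)) A₀~B₀)
         (≡.subst (λ A → Associated R A (prod R Bᵈ)) (≡.sym (highCoeff-setCoeff a i aᵢ last≢i)) Aᵈ~Bᵈ)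
         z root
  where
  open CommutativeRing R hiding (zero)
  open IsUFD ufd using (isIntegralDomain)
  open DomainFacts R isIntegralDomain
  open FracOps R isIntegralDomain
  open ClearedDenominators R isIntegralDomain
  open Factorisation R ufd

  0≢i : zero ≢ i
  0≢i 0≡i = <-irrefl (≡.cong toℕ 0≡i) 0<i

  last≢i : fromℕ d ≢ i
  last≢i last≡i = <-irrefl (≡.trans (≡.sym (≡.cong toℕ last≡i)) (toℕ-fromℕ d)) i<d

  A₀ Aᵈ : Carrier
  A₀ = num (head a) * denProd (tail (setCoeff a i 0#))
  Aᵈ = num (last a) * denProd (init (setCoeff a i 0#))

  A₀≉0 : ¬ A₀ ≈ 0#
  A₀≉0 = *-nonzero (proj₁ (*K-nonzero (a zero) (a (fromℕ d)) a₀aᵈ≉0))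
                   (denProd-nonzero (tail (setCoeff a i 0#)))

  Aᵈ≉0 : ¬ Aᵈ ≈ 0#
  Aᵈ≉0 = *-nonzero (proj₂ (*K-nonzero (a zero) (a (fromℕ d)) a₀aᵈ≉0))
                   (denProd-nonzero (init (setCoeff a i 0#)))
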